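{- Let $\mathcal{R}$ be a commutative ring with unity and $k\in\mathbb{N}$. Let $(a_1,\ldots,a_{2k})\in\mathcal{R}^{2k}$ be such that some $a_i$ is a unit in $\mathcal{R}$. Then for any $1\le l\le 2k$ there exist $g_1,g_2\in SP_{2k}(\mathcal{R})$ such that the $l$-th row of $g_1$ is $(a_1,\ldots,a_{2k})$, i.e. $(g_1)_{l,j}=a_j$ for $1\le j\le 2k$, and the $l$-th column of $g_2$ is $(a_1,\ldots,a_{2k})^t$, i.e. $(g_2)_{j,l}=a_j$ for $1\le j\le 2k$.
   Context: $SP_{2k}(\mathcal{R})=\{A\in M_{2k\times2k}(\mathcal{R})\mid A^tJA=J\}$ with $J=\begin{pmatrix}0&I_k\\-I_k&0\end{pmatrix}$. -}

module Defs where

open import Level using (Level)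
open import Data.Nat using (ℕ) renaming (_+_ to _+ℕ_)
open import Data.Fin using (Fin; splitAt)
open import Data.Fin.Properties using (_≟_)
open import Data.Sum using (inj₁; inj₂)
open import Data.Product using (∃; _×_)
open import Relation.Nullary using (yes; no)
open import Algebra.Bundles using (CommutativeRing)
import Data.Vec.Functional as VF

module Symplectic {c ℓ : Level} (R : CommutativeRing c ℓ) where
  open CommutativeRing R

  Matrix : ℕ → ℕ → Set c
  Matrix m n = Fin m → Fin n → Carrier

  Σ : ∀ {n} → (Fin n → Carrier) → Carrier
  Σ v = VF.foldr _+_ 0# v

  transpose : ∀ {m n} → Matrix m n → Matrix n m
  transpose A i j = A j i

  infixl 7 _⊗_
  _⊗_ : ∀ {m n p} → Matrix m n → Matrix n p → Matrix m p
  (A ⊗ B) i j = Σ (λ t → A i t * B t j)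

  _≈ᴹ_ : ∀ {m n} → Matrix m n → Matrix m n → Set ℓ
  A ≈ᴹ B = ∀ i j → A i j ≈ B i j

  δ : ∀ {k} → Fin k → Fin k → Carrier
  δ p q with p ≟ q
  ... | yes _ = 1#
  ... | no _  = 0#

  -- J = [[0, I_k], [-I_k, 0]] ; indices Fin (k + k), first block = Fin k on the left
  J : ∀ k → Matrix (k +ℕ k) (k +ℕ k)
  J k i j with splitAt k i | splitAt k j
  ... | inj₁ p | inj₁ q = 0#
  ... | inj₁ p | inj₂ q = δ p q
  ... | inj₂ p | inj₁ q = - δ p q
  ... | inj₂ p | inj₂ q = 0#

  IsSymplectic : ∀ k → Matrix (k +ℕ k) (k +ℕ k) → Set ℓ
  IsSymplectic k A = (transpose A ⊗ J k ⊗ A) ≈ᴹ J k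

  IsUnit : Carrier → Set (c Level.⊔ ℓ)
  IsUnit x = ∃ λ y → (x * y ≈ 1#)

{-# OPTIONS --safe #-}
module Submission where

-- Write ω(x, y) = xᵗ J y.  A map of R^{2k} preserving ω has a symplectic matrix, whose
-- columns are the images of the standard basis.  Transvections x ↦ x + ω(x, v) t v preserve ω,
-- and when ω(u, w) t = 1 the one along w − u sends u to w; so two vectors u, w admitting a v
-- with ω(u, v) and ω(w, v) units are joined by a product of two transvections.  For u = e_l
-- and w = a, with a_i a unit, such a v is Jᵗe_l if i = l and Jᵗe_l + (1 − a_l) a_i⁻¹ Jᵗe_i
-- otherwise; this realises a as a column.  For rows, join J e_l to J a by H and take the
-- matrix of the adjoint H*, whose (l, j) entry is ω(J e_l, H* e_j) = ω(H J e_l, e_j) = a_j.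

open import Level using (Level; _⊔_)
open import Algebra.Bundles using (CommutativeRing)
open import Algebra.Solver.Ring.AlmostCommutativeRing using (fromCommutativeRing; _-Raw-AlmostCommutative⟶_)
open import Data.Maybe using (Maybe; just; nothing)
open import Data.Nat as ℕ using (ℕ; zero; suc)
import Data.Nat.Properties as ℕ
open import Data.Integer as ℤ using (ℤ; +_; -[1+_]; _⊖_)
import Data.Integer.Properties as ℤ
open import Data.Sign as Sign using (Sign)
open import Data.Fin using (Fin; zero; suc; _↑ˡ_; _↑ʳ_)
open import Data.Fin.Properties using (_≟_; splitAt-↑ˡ; splitAt-↑ʳ)
open import Data.Vec.Functional using (Vector; _++_)
open import Data.Vec.Functional.Properties using (lookup-++ˡ; lookup-++ʳ)
open import Function using (_∘_)
open import Relation.Binary.PropositionalEquality as ≡ using (_≡_; _≢_; cong)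
open import Relation.Nullary using (yes; no; contradiction)
open import Data.Product using (∃; _×_; _,_)
open import Defs

-- The ring solver needs coefficients whose equality it can decide; ℤ, mapped into R by its
-- canonical homomorphism, serves for every commutative ring.
module IntegerCoefficients {c ℓ : Level} (R : CommutativeRing c ℓ) where
  open CommutativeRing R hiding (zero)
  open import Algebra.Properties.Ring ring using (-‿distribˡ-*; -‿distribʳ-*)
  open import Algebra.Properties.AbelianGroup +-abelianGroup using (⁻¹-∙-comm)
  open import Algebra.Properties.Group +-group using (ε⁻¹≈ε; ⁻¹-involutive)
  open import Algebra.Properties.Semiring.Mult semiring using (×-homo-+; ×1-homo-*) renaming (_×_ to _×ₘ_)
  open import Algebra.Properties.CommutativeSemigroup +-commutativeSemigroup using (interchange)
  open import Relation.Binary.Reasoning.Setoid setoid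

  fromℕ : ℕ → Carrier
  fromℕ n = n ×ₘ 1#

  fromℤ : ℤ → Carrier
  fromℤ (+ n)    = fromℕ n
  fromℤ -[1+ n ] = - fromℕ (suc n)

  signed : Sign → Carrier → Carrier
  signed Sign.+ x = x
  signed Sign.- x = - x

  signed-cong : ∀ s {x y} → x ≈ y → signed s x ≈ signed s y
  signed-cong Sign.+ x≈y = x≈y
  signed-cong Sign.- x≈y = -‿cong x≈y

  signed-* : ∀ s t x y → signed (s Sign.* t) (x * y) ≈ signed s x * signed t y
  signed-* Sign.+ Sign.+ x y = refl
  signed-* Sign.+ Sign.- x y = -‿distribʳ-* x y
  signed-* Sign.- Sign.+ x y = -‿distribˡ-* x y
  signed-* Sign.- Sign.- x y = begin
    x * y           ≈⟨ ⁻¹-involutive (x * y) ⟨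
    - - (x * y)     ≈⟨ -‿cong (-‿distribˡ-* x y) ⟩
    - (- x * y)     ≈⟨ -‿distribʳ-* (- x) y ⟩
    - x * - y       ∎

  fromℤ-sign : ∀ x → fromℤ x ≈ signed (ℤ.sign x) (fromℕ ℤ.∣ x ∣)
  fromℤ-sign (+ zero)  = refl
  fromℤ-sign (+ suc n) = refl
  fromℤ-sign -[1+ n ]  = refl

  fromℤ-◃ : ∀ s n → fromℤ (s ℤ.◃ n) ≈ signed s (fromℕ n)
  fromℤ-◃ Sign.- zero    = sym ε⁻¹≈ε
  fromℤ-◃ Sign.+ zero    = refl
  fromℤ-◃ Sign.- (suc n) = refl
  fromℤ-◃ Sign.+ (suc n) = refl

  fromℤ-⊖ : ∀ m n → fromℤ (m ⊖ n) ≈ fromℕ m - fromℕ n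
  fromℤ-⊖ m       zero    = sym (trans (+-congˡ ε⁻¹≈ε) (+-identityʳ (fromℕ m)))
  fromℤ-⊖ zero    (suc n) = sym (+-identityˡ _)
  fromℤ-⊖ (suc m) (suc n) rewrite ℤ.[1+m]⊖[1+n]≡m⊖n m n = begin
    fromℤ (m ⊖ n)                      ≈⟨ fromℤ-⊖ m n ⟩
    fromℕ m - fromℕ n                  ≈⟨ +-identityˡ _ ⟨
    0# + (fromℕ m - fromℕ n)           ≈⟨ +-congʳ (-‿inverseʳ 1#) ⟨
    (1# - 1#) + (fromℕ m - fromℕ n)    ≈⟨ interchange 1# (fromℕ m) (- 1#) (- fromℕ n) ⟨
    (1# + fromℕ m) + (- 1# - fromℕ n)  ≈⟨ +-congˡ (⁻¹-∙-comm 1# (fromℕ n)) ⟩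
    (1# + fromℕ m) - (1# + fromℕ n)    ∎

  fromℤ-+ : ∀ x y → fromℤ (x ℤ.+ y) ≈ fromℤ x + fromℤ y
  fromℤ-+ -[1+ m ] -[1+ n ] = begin
    - fromℕ (suc (suc (m ℕ.+ n)))      ≡⟨ cong (λ z → - fromℕ (suc z)) (ℕ.+-suc m n) ⟨
    - fromℕ (suc m ℕ.+ suc n)          ≈⟨ -‿cong (×-homo-+ 1# (suc m) (suc n)) ⟩
    - (fromℕ (suc m) + fromℕ (suc n))  ≈⟨ ⁻¹-∙-comm _ _ ⟨
    - fromℕ (suc m) + - fromℕ (suc n)  ∎
  fromℤ-+ -[1+ m ] (+ n)    = trans (fromℤ-⊖ n (suc m)) (+-comm _ _)
  fromℤ-+ (+ m)    -[1+ n ] = fromℤ-⊖ m (suc n)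
  fromℤ-+ (+ m)    (+ n)    = ×-homo-+ 1# m n

  fromℤ-* : ∀ x y → fromℤ (x ℤ.* y) ≈ fromℤ x * fromℤ y
  fromℤ-* x y = begin
    fromℤ (x ℤ.* y)                                      ≈⟨ fromℤ-◃ (s Sign.* t) (ℤ.∣ x ∣ ℕ.* ℤ.∣ y ∣) ⟩
    signed (s Sign.* t) (fromℕ (ℤ.∣ x ∣ ℕ.* ℤ.∣ y ∣))    ≈⟨ signed-cong (s Sign.* t) (×1-homo-* ℤ.∣ x ∣ ℤ.∣ y ∣) ⟩
    signed (s Sign.* t) (fromℕ ℤ.∣ x ∣ * fromℕ ℤ.∣ y ∣)  ≈⟨ signed-* s t _ _ ⟩
    signed s (fromℕ ℤ.∣ x ∣) * signed t (fromℕ ℤ.∣ y ∣)  ≈⟨ *-cong (fromℤ-sign x) (fromℤ-sign y) ⟨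
    fromℤ x * fromℤ y                                    ∎
    where
    s t : Sign
    s = ℤ.sign x
    t = ℤ.sign y

  fromℤ-neg : ∀ x → fromℤ (ℤ.- x) ≈ - fromℤ x
  fromℤ-neg (+ zero)  = sym ε⁻¹≈ε
  fromℤ-neg (+ suc n) = refl
  fromℤ-neg -[1+ n ]  = sym (⁻¹-involutive _)

  fromℤ-homomorphism : ℤ.+-*-rawRing -Raw-AlmostCommutative⟶ fromCommutativeRing R
  fromℤ-homomorphism = record
    { ⟦_⟧    = fromℤ
    ; +-homo = fromℤ-+
    ; *-homo = fromℤ-*
    ; -‿homo = fromℤ-neg
    ; 0-homo = refl
    ; 1-homo = +-identityʳ 1#
    }

  fromℤ-≟ : ∀ x y → Maybe (fromℤ x ≈ fromℤ y)
  fromℤ-≟ x y with x ℤ.≟ y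
  ... | yes ≡.refl = just refl
  ... | no _       = nothing

  open import Algebra.Solver.Ring ℤ.+-*-rawRing (fromCommutativeRing R) fromℤ-homomorphism fromℤ-≟ public


module Sums {c ℓ : Level} (R : CommutativeRing c ℓ) where
  open CommutativeRing R hiding (zero)
  open Symplectic R using (δ)
  open import Algebra.Properties.Semiring.Sum semiring public
  open import Algebra.Properties.AbelianGroup +-abelianGroup using (⁻¹-∙-comm)
  open import Algebra.Properties.Group +-group using (ε⁻¹≈ε)
  open import Relation.Binary.Reasoning.Setoid setoid

  sum-split : ∀ m {n} (f : Vector Carrier (m ℕ.+ n)) →
              sum f ≈ sum (λ q → f (q ↑ˡ n)) + sum (λ q → f (m ↑ʳ q))
  sum-split zero    f = sym (+-identityˡ _)
  sum-split (suc m) f = trans (+-congˡ (sum-split m (f ∘ suc))) (sym (+-assoc _ _ _))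

  sum-neg : ∀ {n} (f : Vector Carrier n) → sum (λ i → - f i) ≈ - sum f
  sum-neg {zero}  f = sym ε⁻¹≈ε
  sum-neg {suc n} f = trans (+-congˡ (sum-neg (f ∘ suc))) (⁻¹-∙-comm _ _)

  sum-zero : ∀ {n} {f : Vector Carrier n} → (∀ i → f i ≈ 0#) → sum f ≈ 0#
  sum-zero {n} f≈0 = trans (sum-cong-≋ f≈0) (sum-replicate-zero n)

  sum-linear : ∀ {n} {f g h : Vector Carrier n} c → (∀ i → f i ≈ g i + c * h i) →
               sum f ≈ sum g + c * sum h
  sum-linear {f = f} {g} {h} c f≈g+ch = begin
    sum f                         ≈⟨ sum-cong-≋ f≈g+ch ⟩
    sum (λ i → g i + c * h i)     ≈⟨ ∑-distrib-+ g (λ i → c * h i) ⟩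
    sum g + sum (λ i → c * h i)   ≈⟨ +-congˡ (*-distribˡ-sum c h) ⟨
    sum g + c * sum h             ∎

  δ-suc : ∀ {n} (p q : Fin n) → δ (suc p) (suc q) ≡ δ p q
  δ-suc p q with p ≟ q
  ... | yes _ = ≡.refl
  ... | no _  = ≡.refl

  δ-refl : ∀ {n} (p : Fin n) → δ p p ≈ 1#
  δ-refl p with p ≟ p
  ... | yes _   = refl
  ... | no p≢p = contradiction ≡.refl p≢p

  δ-≢ : ∀ {n} {p q : Fin n} → p ≢ q → δ p q ≈ 0#
  δ-≢ {p = p} {q} p≢q with p ≟ q
  ... | yes p≡q = contradiction p≡q p≢q
  ... | no _    = refl

  sum-δˡ : ∀ {n} (f : Vector Carrier n) i → sum (λ s → δ s i * f s) ≈ f i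
  sum-δˡ {suc n} f zero = begin
    1# * f zero + sum (λ s → 0# * f (suc s))  ≈⟨ +-cong (*-identityˡ _) (sum-zero (λ s → zeroˡ (f (suc s)))) ⟩
    f zero + 0#                               ≈⟨ +-identityʳ _ ⟩
    f zero                                    ∎
  sum-δˡ {suc n} f (suc i) = begin
    0# * f zero + sum (λ s → δ (suc s) (suc i) * f (suc s))  ≈⟨ +-congʳ (zeroˡ _) ⟩
    0# + sum (λ s → δ (suc s) (suc i) * f (suc s))           ≈⟨ +-identityˡ _ ⟩
    sum (λ s → δ (suc s) (suc i) * f (suc s))                ≈⟨ sum-cong-≋ (λ s → *-congʳ (reflexive (δ-suc s i))) ⟩
    sum (λ s → δ s i * f (suc s))                            ≈⟨ sum-δˡ (f ∘ suc) i ⟩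
    f (suc i)                                                ∎

  sum-δʳ : ∀ {n} (f : Vector Carrier n) i → sum (λ s → f s * δ s i) ≈ f i
  sum-δʳ f i = trans (sum-cong-≋ (λ s → *-comm (f s) (δ s i))) (sum-δˡ f i)


module SymplecticSpace {c ℓ : Level} (R : CommutativeRing c ℓ) (k : ℕ) where
  open CommutativeRing R hiding (zero)
  open Symplectic R
  open Sums R
  open IntegerCoefficients R using (solve; _:=_; _:+_; _:*_; _:-_; :-_; con)
  open import Data.Vec.Functional.Relation.Binary.Equality.Setoid setoid using (_≋_)
  open import Relation.Binary.Reasoning.Setoid setoid

  V : Set c
  V = Vector Carrier (k ℕ.+ k)

  ι₁ ι₂ : Fin k → Fin (k ℕ.+ k)
  ι₁ q = q ↑ˡ k
  ι₂ q = k ↑ʳ q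

  sum-halves : (f : V) → sum f ≈ sum (λ q → f (ι₁ q) + f (ι₂ q))
  sum-halves f = trans (sum-split k f) (sym (∑-distrib-+ (f ∘ ι₁) (f ∘ ι₂)))

  infixl 6 _+ᵥ_ _-ᵥ_
  infixr 7 _·ᵥ_
  infix  7 _·_

  _+ᵥ_ _-ᵥ_ : V → V → V
  (x +ᵥ y) s = x s + y s
  (x -ᵥ y) s = x s - y s

  _·ᵥ_ : Carrier → V → V
  (a ·ᵥ x) s = a * x s

  _·_ : V → V → Carrier
  x · y = sum (λ s → x s * y s)

  e : Fin (k ℕ.+ k) → V
  e j s = δ s j

  ·-eˡ : ∀ x j → e j · x ≈ x j
  ·-eˡ x j = sum-δˡ x j

  ·-eʳ : ∀ x j → x · e j ≈ x j
  ·-eʳ x j = sum-δʳ x j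

  ω : V → V → Carrier
  ω x y = sum (λ q → x (ι₁ q) * y (ι₂ q) - x (ι₂ q) * y (ι₁ q))

  ω-congˡ : ∀ {x x′} y → x ≋ x′ → ω x y ≈ ω x′ y
  ω-congˡ y x≋x′ = sum-cong-≋ (λ q → +-cong (*-congʳ (x≋x′ (ι₁ q))) (-‿cong (*-congʳ (x≋x′ (ι₂ q)))))

  ω-linearˡ : ∀ x a v y → ω (x +ᵥ a ·ᵥ v) y ≈ ω x y + a * ω v y
  ω-linearˡ x a v y = sum-linear a (λ q → solve 7 (λ x₁ x₂ v₁ v₂ y₁ y₂ a →
      (x₁ :+ a :* v₁) :* y₂ :- (x₂ :+ a :* v₂) :* y₁ := (x₁ :* y₂ :- x₂ :* y₁) :+ a :* (v₁ :* y₂ :- v₂ :* y₁))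
    refl (x (ι₁ q)) (x (ι₂ q)) (v (ι₁ q)) (v (ι₂ q)) (y (ι₁ q)) (y (ι₂ q)) a)

  ω-linearʳ : ∀ x y a w → ω x (y +ᵥ a ·ᵥ w) ≈ ω x y + a * ω x w
  ω-linearʳ x y a w = sum-linear a (λ q → solve 7 (λ x₁ x₂ y₁ y₂ w₁ w₂ a →
      x₁ :* (y₂ :+ a :* w₂) :- x₂ :* (y₁ :+ a :* w₁) := (x₁ :* y₂ :- x₂ :* y₁) :+ a :* (x₁ :* w₂ :- x₂ :* w₁))
    refl (x (ι₁ q)) (x (ι₂ q)) (y (ι₁ q)) (y (ι₂ q)) (w (ι₁ q)) (w (ι₂ q)) a)

  ω-self : ∀ x → ω x x ≈ 0#
  ω-self x = sum-zero (λ q →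
    solve 2 (λ x₁ x₂ → x₁ :* x₂ :- x₂ :* x₁ := con (+ 0)) refl (x (ι₁ q)) (x (ι₂ q)))

  ω-antisym : ∀ x y → ω x y ≈ - ω y x
  ω-antisym x y = trans (sum-cong-≋ (λ q → solve 4 (λ x₁ x₂ y₁ y₂ →
      x₁ :* y₂ :- x₂ :* y₁ := :- (y₁ :* x₂ :- y₂ :* x₁)) refl (x (ι₁ q)) (x (ι₂ q)) (y (ι₁ q)) (y (ι₂ q))))
    (sum-neg (λ q → y (ι₁ q) * x (ι₂ q) - y (ι₂ q) * x (ι₁ q)))

  ω-subʳ-self : ∀ x y → ω x (y -ᵥ x) ≈ ω x y
  ω-subʳ-self x y = sum-cong-≋ (λ q → solve 4 (λ x₁ x₂ y₁ y₂ →
      x₁ :* (y₂ :- x₂) :- x₂ :* (y₁ :- x₁) := x₁ :* y₂ :- x₂ :* y₁) refl (x (ι₁ q)) (x (ι₂ q)) (y (ι₁ q)) (y (ι₂ q)))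

  J-ι₁ι₁ : ∀ p q → J k (ι₁ p) (ι₁ q) ≡ 0#
  J-ι₁ι₁ p q rewrite splitAt-↑ˡ k p k | splitAt-↑ˡ k q k = ≡.refl

  J-ι₁ι₂ : ∀ p q → J k (ι₁ p) (ι₂ q) ≡ δ p q
  J-ι₁ι₂ p q rewrite splitAt-↑ˡ k p k | splitAt-↑ʳ k k q = ≡.refl

  J-ι₂ι₁ : ∀ p q → J k (ι₂ p) (ι₁ q) ≡ - δ p q
  J-ι₂ι₁ p q rewrite splitAt-↑ʳ k k p | splitAt-↑ˡ k q k = ≡.refl

  J-ι₂ι₂ : ∀ p q → J k (ι₂ p) (ι₂ q) ≡ 0#
  J-ι₂ι₂ p q rewrite splitAt-↑ʳ k k p | splitAt-↑ʳ k k q = ≡.refl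

  infix 8 _ᵗJ
  _ᵗJ : V → V
  (x ᵗJ) t = sum (λ s → x s * J k s t)

  ᵗJ-ι₁ : ∀ x q → (x ᵗJ) (ι₁ q) ≈ - x (ι₂ q)
  ᵗJ-ι₁ x q = begin
    (x ᵗJ) (ι₁ q)                                                           ≈⟨ sum-halves _ ⟩
    sum (λ p → x (ι₁ p) * J k (ι₁ p) (ι₁ q) + x (ι₂ p) * J k (ι₂ p) (ι₁ q)) ≈⟨ sum-cong-≋ entry ⟩
    sum (λ p → δ p q * - x (ι₂ p))                                          ≈⟨ sum-δˡ (λ p → - x (ι₂ p)) q ⟩
    - x (ι₂ q)                                                              ∎
    where
    entry : ∀ p → x (ι₁ p) * J k (ι₁ p) (ι₁ q) + x (ι₂ p) * J k (ι₂ p) (ι₁ q) ≈ δ p q * - x (ι₂ p)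
    entry p rewrite J-ι₁ι₁ p q | J-ι₂ι₁ p q =
      solve 3 (λ x₁ x₂ d → x₁ :* con (+ 0) :+ x₂ :* (:- d) := d :* (:- x₂)) refl (x (ι₁ p)) (x (ι₂ p)) (δ p q)

  ᵗJ-ι₂ : ∀ x q → (x ᵗJ) (ι₂ q) ≈ x (ι₁ q)
  ᵗJ-ι₂ x q = begin
    (x ᵗJ) (ι₂ q)                                                           ≈⟨ sum-halves _ ⟩
    sum (λ p → x (ι₁ p) * J k (ι₁ p) (ι₂ q) + x (ι₂ p) * J k (ι₂ p) (ι₂ q)) ≈⟨ sum-cong-≋ entry ⟩
    sum (λ p → δ p q * x (ι₁ p))                                            ≈⟨ sum-δˡ (x ∘ ι₁) q ⟩
    x (ι₁ q)                                                                ∎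
    where
    entry : ∀ p → x (ι₁ p) * J k (ι₁ p) (ι₂ q) + x (ι₂ p) * J k (ι₂ p) (ι₂ q) ≈ δ p q * x (ι₁ p)
    entry p rewrite J-ι₁ι₂ p q | J-ι₂ι₂ p q =
      solve 3 (λ x₁ x₂ d → x₁ :* d :+ x₂ :* con (+ 0) := d :* x₁) refl (x (ι₁ p)) (x (ι₂ p)) (δ p q)

  ᵗJ·≈ω : ∀ x y → x ᵗJ · y ≈ ω x y
  ᵗJ·≈ω x y = trans (sum-halves _) (sum-cong-≋ λ q → begin
    (x ᵗJ) (ι₁ q) * y (ι₁ q) + (x ᵗJ) (ι₂ q) * y (ι₂ q) ≈⟨ +-cong (*-congʳ (ᵗJ-ι₁ x q)) (*-congʳ (ᵗJ-ι₂ x q)) ⟩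
    - x (ι₂ q) * y (ι₁ q) + x (ι₁ q) * y (ι₂ q)          ≈⟨ solve 4 (λ x₁ x₂ y₁ y₂ →
                                                            (:- x₂) :* y₁ :+ x₁ :* y₂ := x₁ :* y₂ :- x₂ :* y₁)
                                                            refl (x (ι₁ q)) (x (ι₂ q)) (y (ι₁ q)) (y (ι₂ q)) ⟩
    x (ι₁ q) * y (ι₂ q) - x (ι₂ q) * y (ι₁ q)            ∎)

  eᵗJe≈J : ∀ i j → e i ᵗJ · e j ≈ J k i j
  eᵗJe≈J i j = trans (·-eʳ (e i ᵗJ) j) (sum-δˡ (λ s → J k s j) i)

  J·_ Jᵗ·_ : V → V
  J·  x = (λ q → x (ι₂ q)) ++ (λ q → - x (ι₁ q))
  Jᵗ· x = (λ q → - x (ι₂ q)) ++ (λ q → x (ι₁ q))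

  ω-J·ˡ : ∀ x y → ω (J· x) y ≈ x · y
  ω-J·ˡ x y = sym (trans (sum-halves _) (sum-cong-≋ entry))
    where
    entry : ∀ q → x (ι₁ q) * y (ι₁ q) + x (ι₂ q) * y (ι₂ q) ≈ (J· x) (ι₁ q) * y (ι₂ q) - (J· x) (ι₂ q) * y (ι₁ q)
    entry q rewrite lookup-++ˡ (x ∘ ι₂) (λ p → - x (ι₁ p)) q | lookup-++ʳ (x ∘ ι₂) (λ p → - x (ι₁ p)) q =
      solve 4 (λ x₁ x₂ y₁ y₂ → x₁ :* y₁ :+ x₂ :* y₂ := x₂ :* y₂ :- (:- x₁) :* y₁)
        refl (x (ι₁ q)) (x (ι₂ q)) (y (ι₁ q)) (y (ι₂ q))

  ω-Jᵗ·ʳ : ∀ x y → ω x (Jᵗ· y) ≈ x · y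
  ω-Jᵗ·ʳ x y = sym (trans (sum-halves _) (sum-cong-≋ entry))
    where
    entry : ∀ q → x (ι₁ q) * y (ι₁ q) + x (ι₂ q) * y (ι₂ q) ≈ x (ι₁ q) * (Jᵗ· y) (ι₂ q) - x (ι₂ q) * (Jᵗ· y) (ι₁ q)
    entry q rewrite lookup-++ˡ (λ p → - y (ι₂ p)) (y ∘ ι₁) q | lookup-++ʳ (λ p → - y (ι₂ p)) (y ∘ ι₁) q =
      solve 4 (λ x₁ x₂ y₁ y₂ → x₁ :* y₁ :+ x₂ :* y₂ := x₁ :* y₁ :- x₂ :* (:- y₂))
        refl (x (ι₁ q)) (x (ι₂ q)) (y (ι₁ q)) (y (ι₂ q))

  ω-J·-e : ∀ x j → ω (J· x) (e j) ≈ x j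
  ω-J·-e x j = trans (ω-J·ˡ x (e j)) (·-eʳ x j)

  ω-Jᵗ·-e : ∀ x j → ω x (Jᵗ· e j) ≈ x j
  ω-Jᵗ·-e x j = trans (ω-Jᵗ·ʳ x (e j)) (·-eʳ x j)

  τ : V → Carrier → V → V
  τ v t x = x +ᵥ (ω x v * t) ·ᵥ v

  τ-cong : ∀ v t {x y} → x ≋ y → τ v t x ≋ τ v t y
  τ-cong v t x≋y s = +-cong (x≋y s) (*-congʳ (*-congʳ (ω-congˡ v x≋y)))

  τ-preserves : ∀ v t x y → ω (τ v t x) (τ v t y) ≈ ω x y
  τ-preserves v t x y = begin
    ω (τ v t x) (τ v t y)                                              ≈⟨ ω-linearˡ x (ω x v * t) v (τ v t y) ⟩
    ω x (τ v t y) + (ω x v * t) * ω v (τ v t y)                        ≈⟨ +-cong (ω-linearʳ x y (ω y v * t) v)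
                                                                            (*-congˡ (ω-linearʳ v y (ω y v * t) v)) ⟩
    (ω x y + (ω y v * t) * ω x v) + (ω x v * t) * (ω v y + (ω y v * t) * ω v v)
                                                                       ≈⟨ +-congˡ (*-congˡ (+-cong (ω-antisym v y) (*-congˡ (ω-self v)))) ⟩
    (ω x y + (ω y v * t) * ω x v) + (ω x v * t) * (- ω y v + (ω y v * t) * 0#)
                                                                       ≈⟨ solve 4 (λ W P Q t →
                                                                            (W :+ (Q :* t) :* P) :+ (P :* t) :* (:- Q :+ (Q :* t) :* con (+ 0)) := W)
                                                                            refl (ω x y) (ω x v) (ω y v) t ⟩
    ω x y                                                              ∎

  τ-adjoint : ∀ v t x y → ω x (τ v (- t) y) ≈ ω (τ v t x) y
  τ-adjoint v t x y = begin
    ω x (τ v (- t) y)                   ≈⟨ ω-linearʳ x y (ω y v * - t) v ⟩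
    ω x y + (ω y v * - t) * ω x v       ≈⟨ solve 4 (λ W P Q t → W :+ (Q :* (:- t)) :* P := W :+ (P :* t) :* (:- Q))
                                             refl (ω x y) (ω x v) (ω y v) t ⟩
    ω x y + (ω x v * t) * - ω y v       ≈⟨ +-congˡ (*-congˡ (ω-antisym v y)) ⟨
    ω x y + (ω x v * t) * ω v y         ≈⟨ ω-linearˡ x (ω x v * t) v y ⟨
    ω (τ v t x) y                       ∎

  τ-sends : ∀ {u w t} → ω u w * t ≈ 1# → τ (w -ᵥ u) t u ≋ w
  τ-sends {u} {w} {t} ωuw*t≈1 s = begin
    u s + (ω u (w -ᵥ u) * t) * (w s - u s)  ≈⟨ +-congˡ (*-congʳ (trans (*-congʳ (ω-subʳ-self u w)) ωuw*t≈1)) ⟩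
    u s + 1# * (w s - u s)                  ≈⟨ +-congˡ (*-identityˡ _) ⟩
    u s + (w s - u s)                       ≈⟨ solve 2 (λ u w → u :+ (w :- u) := w) refl (u s) (w s) ⟩
    w s                                     ∎

  record SymplecticMap : Set (c ⊔ ℓ) where
    field
      apply             : V → V
      adjoint           : V → V
      apply-preserves   : ∀ x y → ω (apply x) (apply y) ≈ ω x y
      adjoint-preserves : ∀ x y → ω (adjoint x) (adjoint y) ≈ ω x y
      adjoint-spec      : ∀ x y → ω x (adjoint y) ≈ ω (apply x) y

  open SymplecticMap

  transvection : V → Carrier → SymplecticMap
  transvection v t = record
    { apply             = τ v t
    ; adjoint           = τ v (- t)
    ; apply-preserves   = τ-preserves v t
    ; adjoint-preserves = τ-preserves v (- t)
    ; adjoint-spec      = τ-adjoint v t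
    }

  infixr 9 _∘ₛ_
  _∘ₛ_ : SymplecticMap → SymplecticMap → SymplecticMap
  G ∘ₛ H = record
    { apply             = apply G ∘ apply H
    ; adjoint           = adjoint H ∘ adjoint G
    ; apply-preserves   = λ x y → trans (apply-preserves G _ _) (apply-preserves H x y)
    ; adjoint-preserves = λ x y → trans (adjoint-preserves H _ _) (adjoint-preserves G x y)
    ; adjoint-spec      = λ x y → trans (adjoint-spec H x _) (adjoint-spec G _ y)
    }

  ω-swap-unit : ∀ x y {t} → ω x y * t ≈ 1# → ω y x * - t ≈ 1#
  ω-swap-unit x y {t} ωxy*t≈1 = begin
    ω y x * - t     ≈⟨ *-congʳ (ω-antisym y x) ⟩
    - ω x y * - t   ≈⟨ solve 2 (λ a t → (:- a) :* (:- t) := a :* t) refl (ω x y) t ⟩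
    ω x y * t       ≈⟨ ωxy*t≈1 ⟩
    1#              ∎

  transvections-connect : ∀ u v w → IsUnit (ω u v) → IsUnit (ω w v) → ∃ λ H → apply H u ≋ w
  transvections-connect u v w (t₁ , ωuv*t₁≈1) (t₂ , ωwv*t₂≈1) =
    transvection (w -ᵥ v) (- t₂) ∘ₛ transvection (v -ᵥ u) t₁ ,
    λ s → trans (τ-cong (w -ᵥ v) (- t₂) (τ-sends ωuv*t₁≈1) s) (τ-sends (ω-swap-unit w v ωwv*t₂≈1) s)

  matrixOf : (V → V) → Matrix (k ℕ.+ k) (k ℕ.+ k)
  matrixOf F i j = F (e j) i

  preserves⇒symplectic : ∀ F → (∀ x y → ω (F x) (F y) ≈ ω x y) → IsSymplectic k (matrixOf F)
  preserves⇒symplectic F F-preserves i j = begin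
    F (e i) ᵗJ · F (e j)  ≈⟨ ᵗJ·≈ω (F (e i)) (F (e j)) ⟩
    ω (F (e i)) (F (e j)) ≈⟨ F-preserves (e i) (e j) ⟩
    ω (e i) (e j)         ≈⟨ ᵗJ·≈ω (e i) (e j) ⟨
    e i ᵗJ · e j          ≈⟨ eᵗJe≈J i j ⟩
    J k i j               ∎

  ≈1⇒unit : ∀ {x} → x ≈ 1# → IsUnit x
  ≈1⇒unit {x} x≈1 = 1# , trans (*-identityʳ x) x≈1

  unit-partner : ∀ {a : V} {i} → IsUnit (a i) → ∀ {l} u w (β : Fin (k ℕ.+ k) → V) →
                 (∀ j → ω u (β j) ≈ e l j) → (∀ j → ω w (β j) ≈ a j) →
                 ∃ λ v → IsUnit (ω u v) × IsUnit (ω w v)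
  unit-partner {a} {i} (b , aᵢb≈1) {l} u w β ωuβ≈e ωwβ≈a with i ≟ l
  ... | yes ≡.refl = β i , ≈1⇒unit (trans (ωuβ≈e i) (δ-refl i)) ,
                     (b , trans (*-congʳ (ωwβ≈a i)) aᵢb≈1)
  ... | no i≢l     = β l +ᵥ r ·ᵥ β i , ≈1⇒unit ωuv≈1 , ≈1⇒unit ωwv≈1
    where
    r : Carrier
    r = (1# - a l) * b
    ωuv≈1 : ω u (β l +ᵥ r ·ᵥ β i) ≈ 1#
    ωuv≈1 = begin
      ω u (β l +ᵥ r ·ᵥ β i)        ≈⟨ ω-linearʳ u (β l) r (β i) ⟩
      ω u (β l) + r * ω u (β i)    ≈⟨ +-cong (trans (ωuβ≈e l) (δ-refl l)) (*-congˡ (trans (ωuβ≈e i) (δ-≢ i≢l))) ⟩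
      1# + r * 0#                  ≈⟨ +-congˡ (zeroʳ r) ⟩
      1# + 0#                      ≈⟨ +-identityʳ 1# ⟩
      1#                           ∎
    ωwv≈1 : ω w (β l +ᵥ r ·ᵥ β i) ≈ 1#
    ωwv≈1 = begin
      ω w (β l +ᵥ r ·ᵥ β i)              ≈⟨ ω-linearʳ w (β l) r (β i) ⟩
      ω w (β l) + r * ω w (β i)          ≈⟨ +-cong (ωwβ≈a l) (*-congˡ (ωwβ≈a i)) ⟩
      a l + ((1# - a l) * b) * a i       ≈⟨ +-congˡ (trans (*-assoc _ b (a i)) (*-congˡ (*-comm b (a i)))) ⟩
      a l + (1# - a l) * (a i * b)       ≈⟨ +-congˡ (trans (*-congˡ aᵢb≈1) (*-identityʳ _)) ⟩
      a l + (1# - a l)                   ≈⟨ solve 2 (λ x y → x :+ (y :- x) := y) refl (a l) 1# ⟩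
      1#                                 ∎

  column-realisable : ∀ {a : V} {i} → IsUnit (a i) → ∀ l →
                      ∃ λ g → IsSymplectic k g × ∀ j → g j l ≈ a j
  column-realisable {a} unit l =
    let v , ωelv , ωav = unit-partner unit (e l) a (Jᵗ·_ ∘ e) (ω-Jᵗ·-e (e l)) (ω-Jᵗ·-e a)
        H , He≋a       = transvections-connect (e l) v a ωelv ωav
    in matrixOf (apply H) , preserves⇒symplectic (apply H) (apply-preserves H) , He≋a

  matrixOf-adjoint-row : ∀ H {l a} → apply H (J· e l) ≋ J· a → ∀ j → matrixOf (adjoint H) l j ≈ a j
  matrixOf-adjoint-row H {l} {a} HJe≋Ja j = begin
    adjoint H (e j) l               ≈⟨ ·-eˡ (adjoint H (e j)) l ⟨
    e l · adjoint H (e j)           ≈⟨ ω-J·ˡ (e l) (adjoint H (e j)) ⟨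
    ω (J· e l) (adjoint H (e j))    ≈⟨ adjoint-spec H (J· e l) (e j) ⟩
    ω (apply H (J· e l)) (e j)      ≈⟨ ω-congˡ (e j) HJe≋Ja ⟩
    ω (J· a) (e j)                  ≈⟨ ω-J·-e a j ⟩
    a j                             ∎

  row-realisable : ∀ {a : V} {i} → IsUnit (a i) → ∀ l →
                   ∃ λ g → IsSymplectic k g × ∀ j → g l j ≈ a j
  row-realisable {a} unit l =
    let v , ωJelv , ωJav = unit-partner unit (J· e l) (J· a) e (ω-J·-e (e l)) (ω-J·-e a)
        H , HJe≋Ja       = transvections-connect (J· e l) v (J· a) ωJelv ωJav
    in matrixOf (adjoint H) , preserves⇒symplectic (adjoint H) (adjoint-preserves H) ,
       matrixOf-adjoint-row H HJe≋Ja


-- Imported only here: inside the modules above it would clash with the ring's _+_.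
open import Data.Nat using (_+_)

mainTheorem12 : {c ℓ : Level} (R : CommutativeRing c ℓ) (k : ℕ)
    → (a : Fin (k + k) → CommutativeRing.Carrier R)
    → (∃ λ i → Symplectic.IsUnit R (a i))
    → (l : Fin (k + k))
    → ∃ λ g₁ → ∃ λ g₂ → Symplectic.IsSymplectic R k g₁ × Symplectic.IsSymplectic R k g₂
        × (∀ j → CommutativeRing._≈_ R (g₁ l j) (a j))
        × (∀ j → CommutativeRing._≈_ R (g₂ j l) (a j))
mainTheorem12 R k a (i , unit) l =
  let g₁ , g₁-symplectic , g₁-row    = SymplecticSpace.row-realisable R k unit l
      g₂ , g₂-symplectic , g₂-column = SymplecticSpace.column-realisable R k unit l
  in g₁ , g₂ , g₁-symplectic , g₂-symplectic , g₁-row , g₂-column
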